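{- Among all trees $T$ of order $n\ge 3$, the maximum possible value of $\mathrm{Mo}^{\top}(T)$ is $(n-1)(n-3)$, and the only tree of order $n$ attaining this value is the star $K_{1,n-1}$.
   Context: A pendent vertex is a vertex of degree $1$. For a graph $G$ and an edge $\{u,v\}\in E(G)$, let $\ell_G(u,v)$ be the number of pendent vertices of $G$ strictly closer to $u$ than to $v$. The terminal Mostar index is $\mathrm{Mo}^{\top}(G)=\sum_{\{u,v\}\in E(G)}|\ell_G(u,v)-\ell_G(v,u)|$. -}

module Defs where

open import Data.Nat using (ℕ; zero; suc; _+_; _*_; _∸_; _<ᵇ_; ∣_-_∣)
open import Data.Bool using (Bool; true; false; _∧_; _∨_; not; if_then_else_)
open import Data.Fin using (Fin; toℕ; zero; suc) renaming (_≟_ to _≟ᶠ_)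
open import Data.List using (List; map; allFin)
open import Data.Nat.ListAction using (sum)
open import Data.Bool.ListAction using (any)
open import Data.Product using (∃; Σ; _×_)
open import Function.Bundles using (_↔_; Inverse)
open import Relation.Nullary.Decidable using (⌊_⌋)
open import Relation.Binary.PropositionalEquality using (_≡_; _≢_)

record Graph (n : ℕ) : Set where
  field
    adj    : Fin n → Fin n → Bool
    sym    : ∀ i j → adj i j ≡ adj j i
    irrefl : ∀ i → adj i i ≡ false
open Graph public

Σᵥ : ∀ {n} → (Fin n → ℕ) → ℕ
Σᵥ {n} f = sum (map f (allFin n))

b2n : Bool → ℕ
b2n true  = 1
b2n false = 0

degree : ∀ {n} → Graph n → Fin n → ℕ
degree G v = Σᵥ (λ w → b2n (adj G v w))

isPendent : ∀ {n} → Graph n → Fin n → Bool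
isPendent G v = ⌊ degree G v Data.Nat.≟ 1 ⌋

data Walk {n} (G : Graph n) : Fin n → Fin n → ℕ → Set where
  here : ∀ {u} → Walk G u u 0
  step : ∀ {u v w k} → adj G u v ≡ true → Walk G v w k → Walk G u w (suc k)

Connected : ∀ {n} → Graph n → Set
Connected G = ∀ u v → ∃ λ k → Walk G u v k

-- number of edges: unordered pairs {i,j}, counted once via toℕ i < toℕ j
edgeSum : ∀ {n} → Graph n → (Fin n → Fin n → ℕ) → ℕ
edgeSum G f = Σᵥ (λ i → Σᵥ (λ j →
  if (toℕ i <ᵇ toℕ j) ∧ adj G i j then f i j else 0))

numEdges : ∀ {n} → Graph n → ℕ
numEdges G = edgeSum G (λ _ _ → 1)

IsTree : ∀ {n} → Graph n → Set
IsTree {n} G = Connected G × numEdges G ≡ n ∸ 1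

-- within G k u v : there is a walk of length ≤ k from u to v (BFS layers)
within : ∀ {n} → Graph n → ℕ → Fin n → Fin n → Bool
within G zero    u v = ⌊ u ≟ᶠ v ⌋
within G (suc k) u v =
  within G k u v ∨ any (λ w → within G k u w ∧ adj G w v) (allFin _)

-- shortest-path distance: number of k ∈ {0,…,n-1} with no walk of length ≤ k.
-- For vertices in a common component (always the case in a connected graph)
-- this is exactly the usual distance, which is ≤ n - 1.
countBelow : ℕ → (ℕ → Bool) → ℕ
countBelow zero    p = 0
countBelow (suc k) p = countBelow k p + b2n (p k)

dist : ∀ {n} → Graph n → Fin n → Fin n → ℕ
dist {n} G u v = countBelow n (λ k → not (within G k u v))

ℓ : ∀ {n} → Graph n → Fin n → Fin n → ℕ
ℓ G u v = Σᵥ (λ w → b2n (isPendent G w ∧ (dist G w u <ᵇ dist G w v)))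

MoT : ∀ {n} → Graph n → ℕ
MoT G = edgeSum G (λ u v → ∣ ℓ G u v - ℓ G v u ∣)

_≅_ : ∀ {n} → Graph n → Graph n → Set
_≅_ {n} G H = Σ (Fin n ↔ Fin n) λ φ →
  ∀ i j → adj H (Inverse.to φ i) (Inverse.to φ j) ≡ adj G i j

starAdj : ∀ {m} → Fin (suc m) → Fin (suc m) → Bool
starAdj zero    zero    = false
starAdj zero    (suc _) = true
starAdj (suc _) zero    = true
starAdj (suc _) (suc _) = false

star : ∀ m → Graph (suc m)
star m = record { adj = starAdj ; sym = s ; irrefl = r }
  where
  s : ∀ i j → starAdj i j ≡ starAdj j i
  s zero zero = _≡_.refl
  s zero (suc j) = _≡_.refl
  s (suc i) zero = _≡_.refl
  s (suc i) (suc j) = _≡_.refl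
  r : ∀ i → starAdj {m} i i ≡ false
  r zero = _≡_.refl
  r (suc i) = _≡_.refl

-- Let T be a tree with p pendent vertices and u v an edge. Measured from any root, the two ends of an
-- edge lie on different levels, so every pendent vertex is strictly closer to exactly one of u and v:
-- ℓ(u,v) + ℓ(v,u) = p. Walking away from the edge until no further step is possible ends at a pendent
-- vertex on each side, so both terms are at least 1 and the edge contributes at most p − 2. A tree on
-- n ≥ 3 vertices has a non-pendent vertex, so p ≤ n − 1 and Mo⊤(T) ≤ (n − 1)(n − 3). Equality forces
-- p = n − 1: all vertices but one, c, are pendent, and then every vertex hangs directly off c. In the
-- star each edge has a leaf end u with ℓ(u,v) = 1, so it contributes exactly n − 3.
--
-- The two tree facts behind this (no edge within a level, a unique parent) are obtained by counting:
-- every non-root vertex has a neighbour one level down, and there are only n − 1 edges.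

module Submission where

open import Defs hiding (sym)
open import Data.Bool using (Bool; true; false; _∧_; _∨_; not; if_then_else_)
open import Data.Bool.Properties using (T-≡; ∨-zeroʳ; ∧-zeroʳ; ¬-not) renaming (_≟_ to _≟ᵇ_)
open import Data.Bool.ListAction using (any; or)
open import Data.Fin using (Fin; zero; suc; toℕ; fromℕ<)
open import Data.Fin.Properties using (toℕ-injective; toℕ-fromℕ<; any?; all?; ¬∀⟶∃¬) renaming (_≟_ to _≟ᶠ_)
import Data.Fin.Permutation as Permutation
import Data.Fin.Permutation.Components as Transposition
open import Data.List using (allFin; tabulate)
open import Data.List.Properties using (map-tabulate; map-cong)
open import Data.List.Membership.Propositional using (find; lose)
open import Data.List.Membership.Propositional.Properties using (∈-allFin)
open import Data.List.Relation.Unary.Any.Properties using (any⁺; any⁻)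
open import Data.Nat using (ℕ; zero; suc; _+_; _*_; _∸_; _≤_; _<_; _≤′_; ≤′-refl; ≤′-step; >-nonZero;
  z≤n; s≤s; s≤s⁻¹; _<ᵇ_; _≡ᵇ_; ∣_-_∣)
open import Data.Nat.Properties
import Data.Nat.ListAction as List
open import Algebra.Properties.Semiring.Sum +-*-semiring
  using (sum; sum-cong-≗; sum-replicate-zero; ∑-distrib-+; ∑-comm; *-distribˡ-sum)
open import Data.Product using (∃; _×_; _,_; proj₁; proj₂; map₂)
open import Data.Sum using (_⊎_; inj₁; inj₂)
open import Function using (_∘_; id)
open import Function.Bundles using (_⇔_; mk⇔; Inverse; Equivalence)
open import Relation.Binary.Definitions using (tri<; tri≈; tri>)
open import Relation.Binary.PropositionalEquality
open import Relation.Nullary using (¬_; Dec; yes; no; contradiction)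
open import Relation.Nullary.Decidable using (⌊_⌋; toWitness; fromWitness; _×-dec_; ¬?)

⌊⌋-toWitness : ∀ {P : Set} (d : Dec P) → ⌊ d ⌋ ≡ true → P
⌊⌋-toWitness d eq = toWitness {a? = d} (Equivalence.from T-≡ eq)

⌊⌋-fromWitness : ∀ {P : Set} (d : Dec P) → P → ⌊ d ⌋ ≡ true
⌊⌋-fromWitness d p = Equivalence.to T-≡ (fromWitness {a? = d} p)

∨-elim : ∀ a {b} → a ∨ b ≡ true → a ≡ true ⊎ b ≡ true
∨-elim true  _  = inj₁ refl
∨-elim false eq = inj₂ eq

∧-elim : ∀ a {b} → a ∧ b ≡ true → a ≡ true × b ≡ true
∧-elim true eq = refl , eq

any-allFin-intro : ∀ {n} (p : Fin n → Bool) x → p x ≡ true → any p (allFin n) ≡ true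
any-allFin-intro p x px = Equivalence.to T-≡ (any⁺ p (lose (∈-allFin x) (Equivalence.from T-≡ px)))

any-allFin-elim : ∀ {n} (p : Fin n → Bool) → any p (allFin n) ≡ true → ∃ λ x → p x ≡ true
any-allFin-elim p eq with find (any⁻ p (allFin _) (Equivalence.from T-≡ eq))
... | x , _ , px = x , Equivalence.to T-≡ px

b2n≤1 : ∀ b → b2n b ≤ 1
b2n≤1 true  = ≤-refl
b2n≤1 false = z≤n

b2n-mono : ∀ {a b} → (a ≡ true → b ≡ true) → b2n a ≤ b2n b
b2n-mono {false} _   = z≤n
b2n-mono {true}  a⇒b rewrite a⇒b refl = ≤-refl

newly-true : ∀ a b → (a ≡ true → b ≡ true) → b ≢ a → a ≡ false × b ≡ true
newly-true false true  _   _   = refl , refl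
newly-true false false _   b≢a = contradiction refl b≢a
newly-true true  _     a⇒b b≢a = contradiction (a⇒b refl) b≢a

<ᵇ-true : ∀ {a b} → a < b → (a <ᵇ b) ≡ true
<ᵇ-true a<b = Equivalence.to T-≡ (<⇒<ᵇ a<b)

<ᵇ-false : ∀ {a b} → b ≤ a → (a <ᵇ b) ≡ false
<ᵇ-false {a} {b} b≤a with a <ᵇ b in lt
... | false = refl
... | true  = contradiction (<ᵇ⇒< a b (Equivalence.from T-≡ lt)) (≤⇒≯ b≤a)

<ᵇ-sound : ∀ {a b} → (a <ᵇ b) ≡ true → a < b
<ᵇ-sound {a} {b} lt = <ᵇ⇒< a b (Equivalence.from T-≡ lt)

≡ᵇ-true : ∀ {a b} → a ≡ b → (a ≡ᵇ b) ≡ true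
≡ᵇ-true {a} {b} a≡b = Equivalence.to T-≡ (≡⇒≡ᵇ a b a≡b)

≡ᵇ-false : ∀ {a b} → a ≢ b → (a ≡ᵇ b) ≡ false
≡ᵇ-false {a} {b} a≢b with a ≡ᵇ b in eq
... | false = refl
... | true  = contradiction (≡ᵇ⇒≡ a b (Equivalence.from T-≡ eq)) a≢b

≡ᵇ-comm : ∀ a b → (a ≡ᵇ b) ≡ (b ≡ᵇ a)
≡ᵇ-comm zero    zero    = refl
≡ᵇ-comm zero    (suc b) = refl
≡ᵇ-comm (suc a) zero    = refl
≡ᵇ-comm (suc a) (suc b) = ≡ᵇ-comm a b

<ᵇ-trichotomy : ∀ a b → b2n (b <ᵇ a) + b2n (a <ᵇ b) + b2n (a ≡ᵇ b) ≡ 1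
<ᵇ-trichotomy zero    zero    = refl
<ᵇ-trichotomy zero    (suc b) = refl
<ᵇ-trichotomy (suc a) zero    = refl
<ᵇ-trichotomy (suc a) (suc b) = <ᵇ-trichotomy a b

<ᵇ+>ᵇ : ∀ a b → b2n (a <ᵇ b) + b2n (b <ᵇ a) ≡ b2n (not (a ≡ᵇ b))
<ᵇ+>ᵇ zero    zero    = refl
<ᵇ+>ᵇ zero    (suc b) = refl
<ᵇ+>ᵇ (suc a) zero    = refl
<ᵇ+>ᵇ (suc a) (suc b) = <ᵇ+>ᵇ a b

b2n-∧ : ∀ a b → b2n (a ∧ b) ≡ (if a then b2n b else 0)
b2n-∧ true  b = refl
b2n-∧ false b = refl

if-+ : ∀ b x y → (if b then x + y else 0) ≡ (if b then x else 0) + (if b then y else 0)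
if-+ true  x y = refl
if-+ false x y = refl

if-* : ∀ b c → (if b then c else 0) ≡ c * (if b then 1 else 0)
if-* true  c = sym (*-identityʳ c)
if-* false c = sym (*-zeroʳ c)

-- Finite sums and counting

Σᵥ≡sum : ∀ {n} (f : Fin n → ℕ) → Σᵥ f ≡ sum f
Σᵥ≡sum f = trans (cong List.sum (map-tabulate id f)) (sum-tabulate f)
  where
  sum-tabulate : ∀ {n} (g : Fin n → ℕ) → List.sum (tabulate g) ≡ sum g
  sum-tabulate {zero}  g = refl
  sum-tabulate {suc n} g = cong (g zero +_) (sum-tabulate (g ∘ suc))

sum-mono-≤ : ∀ {n} {f g : Fin n → ℕ} → (∀ i → f i ≤ g i) → sum f ≤ sum g
sum-mono-≤ {zero}  f≤g = z≤n
sum-mono-≤ {suc n} f≤g = +-mono-≤ (f≤g zero) (sum-mono-≤ (f≤g ∘ suc))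

sum-mono-< : ∀ {n} {f g : Fin n → ℕ} → (∀ i → f i ≤ g i) → ∀ i → f i < g i → sum f < sum g
sum-mono-< f≤g zero    fi<gi = +-mono-<-≤ fi<gi (sum-mono-≤ (f≤g ∘ suc))
sum-mono-< f≤g (suc i) fi<gi = +-mono-≤-< (f≤g zero) (sum-mono-< (f≤g ∘ suc) i fi<gi)

term≤sum : ∀ {n} (f : Fin n → ℕ) i → f i ≤ sum f
term≤sum f zero    = m≤m+n _ _
term≤sum f (suc i) = ≤-trans (term≤sum (f ∘ suc) i) (m≤n+m _ (f zero))

two-terms≤sum : ∀ {n} (f : Fin n → ℕ) {i j} → i ≢ j → f i + f j ≤ sum f
two-terms≤sum f {zero}  {zero}  i≢j = contradiction refl i≢j
two-terms≤sum f {zero}  {suc j} _   = +-monoʳ-≤ (f zero) (term≤sum (f ∘ suc) j)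
two-terms≤sum f {suc i} {zero}  _   =
  subst (_≤ sum f) (+-comm (f zero) (f (suc i))) (+-monoʳ-≤ (f zero) (term≤sum (f ∘ suc) i))
two-terms≤sum f {suc i} {suc j} i≢j =
  ≤-trans (two-terms≤sum (f ∘ suc) (i≢j ∘ cong suc)) (m≤n+m _ (f zero))

count : ∀ {n} → (Fin n → Bool) → ℕ
count p = sum (λ x → b2n (p x))

count-cong : ∀ {n} {p q : Fin n → Bool} → (∀ x → p x ≡ q x) → count p ≡ count q
count-cong p≗q = sum-cong-≗ (cong b2n ∘ p≗q)

count-true : ∀ n → count {n} (λ _ → true) ≡ n
count-true zero    = refl
count-true (suc n) = cong suc (count-true n)

count-mono : ∀ {n} {p q : Fin n → Bool} → (∀ x → p x ≡ true → q x ≡ true) → count p ≤ count q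
count-mono p⇒q = sum-mono-≤ (λ x → b2n-mono (p⇒q x))

count-mono-< : ∀ {n} {p q : Fin n → Bool} → (∀ x → p x ≡ true → q x ≡ true) →
  ∀ {x} → p x ≡ false → q x ≡ true → count p < count q
count-mono-< p⇒q {x} px qx =
  sum-mono-< (λ y → b2n-mono (p⇒q y)) x (subst₂ (λ a b → b2n a < b2n b) (sym px) (sym qx) ≤-refl)

count≤ : ∀ {n} (p : Fin n → Bool) → count p ≤ n
count≤ {n} p = subst (count p ≤_) (count-true n) (count-mono {n} {p} {λ _ → true} (λ _ _ → refl))

1≤count : ∀ {n} {p : Fin n → Bool} {x} → p x ≡ true → 1 ≤ count p
1≤count {p = p} {x} px = subst (_≤ count p) (cong b2n px) (term≤sum _ x)

2≤count : ∀ {n} {p : Fin n → Bool} {x y} → x ≢ y → p x ≡ true → p y ≡ true → 2 ≤ count p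
2≤count {p = p} x≢y px py =
  subst (_≤ count p) (cong₂ _+_ (cong b2n px) (cong b2n py)) (two-terms≤sum _ x≢y)

count-≟ : ∀ {n} (c : Fin n) → count (λ x → ⌊ x ≟ᶠ c ⌋) ≡ 1
count-≟ {suc n} zero    = cong suc (sum-replicate-zero n)
count-≟ {suc n} (suc c) = trans (count-cong (λ x → suc≟suc x c)) (count-≟ c)
  where
  suc≟suc : ∀ {n} (x c : Fin n) → ⌊ suc x ≟ᶠ suc c ⌋ ≡ ⌊ x ≟ᶠ c ⌋
  suc≟suc x c with x ≟ᶠ c
  ... | yes _ = refl
  ... | no  _ = refl

count-complement : ∀ {n} (p : Fin n → Bool) → count p + count (λ x → not (p x)) ≡ n
count-complement {n} p = begin
  count p + count (λ x → not (p x))     ≡⟨ ∑-distrib-+ (b2n ∘ p) (b2n ∘ not ∘ p) ⟨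
  sum (λ x → b2n (p x) + b2n (not (p x))) ≡⟨ sum-cong-≗ (b2n+b2n-not ∘ p) ⟩
  count {n} (λ _ → true)               ≡⟨ count-true n ⟩
  n                                    ∎
  where
  open ≡-Reasoning
  b2n+b2n-not : ∀ b → b2n b + b2n (not b) ≡ 1
  b2n+b2n-not true  = refl
  b2n+b2n-not false = refl

count-≢ : ∀ {n} (c : Fin (suc n)) → count (λ x → not ⌊ x ≟ᶠ c ⌋) ≡ n
count-≢ c = +-cancelˡ-≡ 1 _ _
  (trans (cong (_+ count (λ x → not ⌊ x ≟ᶠ c ⌋)) (sym (count-≟ c)))
         (count-complement (λ x → ⌊ x ≟ᶠ c ⌋)))

-- Reachability within k steps and distance

module _ {n} (G : Graph n) where

  within-zero : ∀ {u v} → within G 0 u v ≡ true → u ≡ v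
  within-zero {u} {v} = ⌊⌋-toWitness (u ≟ᶠ v)

  within-refl : ∀ u → within G 0 u u ≡ true
  within-refl u = ⌊⌋-fromWitness (u ≟ᶠ u) refl

  within-suc : ∀ {k u v} → within G k u v ≡ true → within G (suc k) u v ≡ true
  within-suc {k} {u} {v} = cong (_∨ any (λ w → within G k u w ∧ adj G w v) (allFin n))

  within-mono : ∀ {k j u v} → k ≤ j → within G k u v ≡ true → within G j u v ≡ true
  within-mono k≤j = go (≤⇒≤′ k≤j)
    where
    go : ∀ {k j u v} → k ≤′ j → within G k u v ≡ true → within G j u v ≡ true
    go ≤′-refl                              eq = eq
    go {u = u} {v} (≤′-step {n = j} k≤′j) eq = within-suc {j} {u} {v} (go k≤′j eq)

  within-extend : ∀ {k u x v} → within G k u x ≡ true → adj G x v ≡ true → within G (suc k) u v ≡ true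
  within-extend {k} {u} {x} {v} ux xv =
    trans (cong (within G k u v ∨_) (any-allFin-intro (λ w → within G k u w ∧ adj G w v) x (cong₂ _∧_ ux xv)))
          (∨-zeroʳ _)

  within-suc-split : ∀ {k u v} → within G (suc k) u v ≡ true →
    within G k u v ≡ true ⊎ ∃ λ x → within G k u x ≡ true × adj G x v ≡ true
  within-suc-split {k} {u} {v} eq with ∨-elim (within G k u v) eq
  ... | inj₁ uv = inj₁ uv
  ... | inj₂ any-x with any-allFin-elim (λ w → within G k u w ∧ adj G w v) any-x
  ...   | x , ux∧xv = inj₂ (x , ∧-elim _ ux∧xv)

  walk⇒within : ∀ {a b j} → Walk G a b j → within G j b a ≡ true
  walk⇒within {a} here = within-refl a
  walk⇒within {a} {b} (step {v = x} {k = j} ax walk) =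
    within-extend {j} {b} {x} {a} (walk⇒within walk) (trans (Graph.sym G x a) ax)

  snoc : ∀ {a b c j} → Walk G a b j → adj G b c ≡ true → Walk G a c (suc j)
  snoc here          bc = step bc here
  snoc (step ax walk) bc = step ax (snoc walk bc)

  within⇒walk : ∀ k {u v} → within G k u v ≡ true → ∃ λ j → j ≤ k × Walk G u v j
  within⇒walk zero {u} {v} eq with within-zero {u} {v} eq
  ... | refl = 0 , z≤n , here
  within⇒walk (suc k) {u} {v} eq with within-suc-split {k} {u} {v} eq
  ... | inj₁ uv with within⇒walk k uv
  ...   | j , j≤k , walk = j , m≤n⇒m≤1+n j≤k , walk
  within⇒walk (suc k) eq | inj₂ (x , ux , xv) with within⇒walk k ux
  ...   | j , j≤k , walk = suc j , s≤s j≤k , snoc walk xv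

  within-sym : ∀ {k u v} → within G k u v ≡ true → within G k v u ≡ true
  within-sym {k} {u} {v} eq with within⇒walk k eq
  ... | j , j≤k , walk = within-mono {j} {k} {v} {u} j≤k (walk⇒within walk)

  within-comm : ∀ k u v → within G k u v ≡ within G k v u
  within-comm k u v with within G k u v in uv | within G k v u in vu
  ... | true  | true  = refl
  ... | false | false = refl
  ... | true  | false = trans (sym (within-sym {k} {u} {v} uv)) vu
  ... | false | true  = trans (sym uv) (within-sym {k} {v} {u} vu)

countBelow≤ : ∀ N p → countBelow N p ≤ N
countBelow≤ zero    p = z≤n
countBelow≤ (suc N) p = subst (countBelow N p + b2n (p N) ≤_) (+-comm N 1)
  (+-mono-≤ (countBelow≤ N p) (b2n≤1 (p N)))

countBelow-false-from : ∀ N j p → (∀ k → j ≤ k → p k ≡ false) → countBelow N p ≤ j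
countBelow-false-from zero    j p _ = z≤n
countBelow-false-from (suc N) j p false-from with j ≤? N
... | yes j≤N rewrite false-from N j≤N | +-identityʳ (countBelow N p) = countBelow-false-from N j p false-from
... | no  j≰N = ≤-trans (countBelow≤ (suc N) p) (≰⇒> j≰N)

countBelow-true-below : ∀ N j p → j ≤ N → (∀ k → k < j → p k ≡ true) → j ≤ countBelow N p
countBelow-true-below zero    zero    p _ _ = z≤n
countBelow-true-below (suc N) j p j≤1+N true-below with j ≤? N
... | yes j≤N = ≤-trans (countBelow-true-below N j p j≤N true-below) (m≤m+n _ _)
... | no  j≰N with ≤-antisym j≤1+N (≰⇒> j≰N)
...   | refl rewrite true-below N ≤-refl = subst (_≤ countBelow N p + 1) (+-comm N 1)
         (+-monoˡ-≤ 1 (countBelow-true-below N N p ≤-refl (λ k k<N → true-below k (m≤n⇒m≤1+n k<N))))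

countBelow-cong : ∀ N {p q} → (∀ k → p k ≡ q k) → countBelow N p ≡ countBelow N q
countBelow-cong zero    p≗q = refl
countBelow-cong (suc N) p≗q = cong₂ _+_ (countBelow-cong N p≗q) (cong b2n (p≗q N))

module _ {n} (G : Graph n) where

  dist-≤ : ∀ {j u v} → within G j u v ≡ true → dist G u v ≤ j
  dist-≤ {j} uv = countBelow-false-from n j _ (λ k j≤k → cong not (within-mono G j≤k uv))

  dist-> : ∀ {j u v} → j < n → within G j u v ≡ false → j < dist G u v
  dist-> {j} {u} {v} j<n ¬uv = countBelow-true-below n (suc j) _ j<n true-below
    where
    true-below : ∀ k → k < suc j → not (within G k u v) ≡ true
    true-below k (s≤s k≤j) with within G k u v in uv
    ... | false = refl
    ... | true  = contradiction (trans (sym (within-mono G k≤j uv)) ¬uv) λ ()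

  within-dist : ∀ {u v} → dist G u v < n → within G (dist G u v) u v ≡ true
  within-dist {u} {v} d<n with within G (dist G u v) u v in uv
  ... | true  = refl
  ... | false = contradiction (dist-> d<n uv) (n≮n _)

  dist-sym : ∀ u v → dist G u v ≡ dist G v u
  dist-sym u v = countBelow-cong n (λ k → cong not (within-comm G k u v))

-- Until the layers stabilise the ball around u gains a vertex at every step, and it has at most m + 1
-- vertices, so it is stable from step m on.
module Ball {m} (G : Graph (suc m)) (u : Fin (suc m)) where

  ball : ℕ → ℕ
  ball k = count (within G k u)

  Stable : ℕ → Set
  Stable k = ∀ x → within G (suc k) u x ≡ within G k u x

  stable? : ∀ k → Dec (Stable k)
  stable? k = all? (λ x → within G (suc k) u x ≟ᵇ within G k u x)

  stable-suc : ∀ {k} → Stable k → Stable (suc k)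
  stable-suc st x = cong₂ _∨_ (st x) (cong or (map-cong (λ w → cong (_∧ adj G w x) (st w)) (allFin _)))

  stable-mono : ∀ {k j} → k ≤′ j → Stable k → Stable j
  stable-mono ≤′-refl            st = st
  stable-mono (≤′-step {j} k≤′j) st = stable-suc {j} (stable-mono k≤′j st)

  stable-within : ∀ {k j} → k ≤′ j → Stable k → ∀ x → within G j u x ≡ within G k u x
  stable-within ≤′-refl            st x = refl
  stable-within (≤′-step {j} k≤′j) st x = trans (stable-mono {j = j} k≤′j st x) (stable-within k≤′j st x)

  ball-grows : ∀ k → ¬ Stable k → ball k < ball (suc k)
  ball-grows k unstable
    with x , differs ← ¬∀⟶∃¬ (suc m) _ (λ x → within G (suc k) u x ≟ᵇ within G k u x) unstable
    with old , new ← newly-true (within G k u x) _ (within-suc G {k} {u} {x}) differs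
    = count-mono-< {p = within G k u} {within G (suc k) u} (λ y → within-suc G {k} {u} {y}) old new

  stable-or-large : ∀ k → (∃ λ j → j ≤ k × Stable j) ⊎ suc k ≤ ball k
  stable-or-large zero = inj₂ (1≤count {p = within G 0 u} (within-refl G u))
  stable-or-large (suc k) with stable-or-large k | stable? k
  ... | inj₁ (j , j≤k , st) | _           = inj₁ (j , m≤n⇒m≤1+n j≤k , st)
  ... | inj₂ _              | yes st      = inj₁ (k , n≤1+n k , st)
  ... | inj₂ large          | no unstable = inj₂ (≤-trans (s≤s large) (ball-grows k unstable))

  stable-by-m : ∃ λ k → k ≤ m × Stable k
  stable-by-m with stable-or-large m | stable? m
  ... | inj₁ found | _           = found
  ... | inj₂ _     | yes st      = m , ≤-refl , st
  ... | inj₂ large | no unstable =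
    contradiction (≤-trans (≤-trans (s≤s large) (ball-grows m unstable)) (count≤ (within G (suc m) u))) 1+n≰n

  within-by-m : ∀ {j x} → within G j u x ≡ true → within G m u x ≡ true
  within-by-m {j} {x} ux with j ≤? m | stable-by-m
  ... | yes j≤m | _            = within-mono G {j} {m} {u} {x} j≤m ux
  ... | no  j≰m | k , k≤m , st =
    within-mono G {k} {m} {u} {x} k≤m (trans (sym (stable-within (≤⇒≤′ k≤j) st x)) ux)
    where
    k≤j : k ≤ j
    k≤j = ≤-trans k≤m (<⇒≤ (≰⇒> j≰m))

dist≤m : ∀ {m} (G : Graph (suc m)) → Connected G → ∀ u v → dist G u v ≤ m
dist≤m G connected u v with j , walk ← connected u v =
  dist-≤ G (Ball.within-by-m G u {j} {v} (within-sym G {j} {v} {u} (walk⇒within G walk)))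

module Distances {m} (G : Graph (suc m)) (connected : Connected G) where

  within-at-dist : ∀ r w → within G (dist G r w) r w ≡ true
  within-at-dist r w = within-dist G (s≤s (dist≤m G connected r w))

  dist-self : ∀ r → dist G r r ≡ 0
  dist-self r = n≤0⇒n≡0 (dist-≤ G {0} {r} {r} (within-refl G r))

  dist≡0⇒≡ : ∀ {r w} → dist G r w ≡ 0 → r ≡ w
  dist≡0⇒≡ {r} {w} eq = within-zero G (subst (λ k → within G k r w ≡ true) eq (within-at-dist r w))

  adj⇒dist≤1+dist : ∀ r {w x} → adj G w x ≡ true → dist G r w ≤ suc (dist G r x)
  adj⇒dist≤1+dist r {w} {x} wx =
    dist-≤ G (within-extend G {dist G r x} {r} {x} {w} (within-at-dist r x) (trans (Graph.sym G x w) wx))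

  parent : ∀ {r w} → r ≢ w → ∃ λ x → adj G w x ≡ true × suc (dist G r x) ≡ dist G r w
  parent {r} {w} r≢w with dist G r w in eq | within-at-dist r w
  ... | zero  | at-0 = contradiction (within-zero G at-0) r≢w
  ... | suc d | at-d with within-suc-split G {d} {r} {w} at-d
  ...   | inj₁ at-d-1 = contradiction (subst (_≤ d) eq (dist-≤ G at-d-1)) 1+n≰n
  ...   | inj₂ (x , rx , xw) = x , wx , cong suc (≤-antisym (dist-≤ G rx) d≤)
    where
    wx : adj G w x ≡ true
    wx = trans (Graph.sym G w x) xw
    d≤ : d ≤ dist G r x
    d≤ = s≤s⁻¹ (subst (_≤ suc (dist G r x)) eq (adj⇒dist≤1+dist r wx))

-- Counting edges

module _ {n} (G : Graph n) where

  adj⇒≢ : ∀ {i j} → adj G i j ≡ true → i ≢ j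
  adj⇒≢ {i} ij refl = contradiction (trans (sym ij) (Graph.irrefl G i)) λ ()

  edgeTerm : (Fin n → Fin n → ℕ) → Fin n → Fin n → ℕ
  edgeTerm f i j = if (toℕ i <ᵇ toℕ j) ∧ adj G i j then f i j else 0

  edgeSum≡sum : ∀ f → edgeSum G f ≡ sum (λ i → sum (edgeTerm f i))
  edgeSum≡sum f = trans (Σᵥ≡sum (λ i → Σᵥ (edgeTerm f i))) (sum-cong-≗ (λ i → Σᵥ≡sum (edgeTerm f i)))

  edgeSum-mono : ∀ {f g} → (∀ i j → adj G i j ≡ true → f i j ≤ g i j) → edgeSum G f ≤ edgeSum G g
  edgeSum-mono {f} {g} f≤g = subst₂ _≤_ (sym (edgeSum≡sum f)) (sym (edgeSum≡sum g))
    (sum-mono-≤ λ i → sum-mono-≤ λ j → term≤ i j)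
    where
    term≤ : ∀ i j → edgeTerm f i j ≤ edgeTerm g i j
    term≤ i j with toℕ i <ᵇ toℕ j | adj G i j in ij
    ... | true  | true  = f≤g i j ij
    ... | true  | false = z≤n
    ... | false | _     = z≤n

  edgeSum-cong : ∀ {f g} → (∀ i j → adj G i j ≡ true → f i j ≡ g i j) → edgeSum G f ≡ edgeSum G g
  edgeSum-cong f≡g = ≤-antisym (edgeSum-mono (λ i j ij → ≤-reflexive (f≡g i j ij)))
                               (edgeSum-mono (λ i j ij → ≤-reflexive (sym (f≡g i j ij))))

  edgeSum-+ : ∀ f g → edgeSum G f + edgeSum G g ≡ edgeSum G (λ i j → f i j + g i j)
  edgeSum-+ f g = begin
    edgeSum G f + edgeSum G g
      ≡⟨ cong₂ _+_ (edgeSum≡sum f) (edgeSum≡sum g) ⟩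
    sum (λ i → sum (edgeTerm f i)) + sum (λ i → sum (edgeTerm g i))
      ≡⟨ ∑-distrib-+ (λ i → sum (edgeTerm f i)) (λ i → sum (edgeTerm g i)) ⟨
    sum (λ i → sum (edgeTerm f i) + sum (edgeTerm g i))
      ≡⟨ sum-cong-≗ (λ i → ∑-distrib-+ (edgeTerm f i) (edgeTerm g i)) ⟨
    sum (λ i → sum (λ j → edgeTerm f i j + edgeTerm g i j))
      ≡⟨ sum-cong-≗ (λ i → sum-cong-≗ (λ j → if-+ ((toℕ i <ᵇ toℕ j) ∧ adj G i j) (f i j) (g i j))) ⟨
    sum (λ i → sum (edgeTerm (λ i j → f i j + g i j) i))
      ≡⟨ edgeSum≡sum (λ i j → f i j + g i j) ⟨
    edgeSum G (λ i j → f i j + g i j) ∎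
    where open ≡-Reasoning

  edgeSum-const : ∀ c → edgeSum G (λ _ _ → c) ≡ c * numEdges G
  edgeSum-const c = begin
    edgeSum G (λ _ _ → c)
      ≡⟨ edgeSum≡sum (λ _ _ → c) ⟩
    sum (λ i → sum (edgeTerm (λ _ _ → c) i))
      ≡⟨ sum-cong-≗ (λ i → sum-cong-≗ (λ j → if-* ((toℕ i <ᵇ toℕ j) ∧ adj G i j) c)) ⟩
    sum (λ i → sum (λ j → c * edgeTerm one i j))
      ≡⟨ sum-cong-≗ (λ i → *-distribˡ-sum c (edgeTerm one i)) ⟨
    sum (λ i → c * sum (edgeTerm one i))
      ≡⟨ *-distribˡ-sum c (λ i → sum (edgeTerm one i)) ⟨
    c * sum (λ i → sum (edgeTerm one i))
      ≡⟨ cong (c *_) (edgeSum≡sum one) ⟨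
    c * numEdges G ∎
    where
    open ≡-Reasoning
    one : Fin n → Fin n → ℕ
    one _ _ = 1

  edgeTerm≤edgeSum : ∀ f a b → edgeTerm f a b ≤ edgeSum G f
  edgeTerm≤edgeSum f a b = subst (edgeTerm f a b ≤_) (sym (edgeSum≡sum f))
    (≤-trans (term≤sum (edgeTerm f a) b) (term≤sum (λ a → sum (edgeTerm f a)) a))

  edgeTerm-edge : ∀ f {a b} → toℕ a < toℕ b → adj G a b ≡ true → edgeTerm f a b ≡ f a b
  edgeTerm-edge f a<b ab rewrite <ᵇ-true a<b | ab = refl

  edge≤edgeSum : ∀ f → (∀ i j → f i j ≡ f j i) → ∀ {i j} → adj G i j ≡ true → f i j ≤ edgeSum G f
  edge≤edgeSum f f-sym {i} {j} ij with <-cmp (toℕ i) (toℕ j)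
  ... | tri< i<j _ _ = subst (_≤ edgeSum G f) (edgeTerm-edge f i<j ij) (edgeTerm≤edgeSum f i j)
  ... | tri≈ _ i≡j _ = contradiction (toℕ-injective i≡j) (adj⇒≢ ij)
  ... | tri> _ _ j<i = subst (_≤ edgeSum G f)
                         (trans (edgeTerm-edge f j<i (trans (Graph.sym G j i) ij)) (f-sym j i))
                         (edgeTerm≤edgeSum f j i)

  adjacency-sum : ∀ g → sum (λ i → sum (λ j → if adj G i j then g i j else 0)) ≡
                        edgeSum G g + edgeSum G (λ i j → g j i)
  adjacency-sum g = begin
    sum (λ i → sum (λ j → if adj G i j then g i j else 0))
      ≡⟨ sum-cong-≗ (λ i → trans (sum-cong-≗ (orientations i))
                                 (∑-distrib-+ (edgeTerm g i) (λ j → edgeTerm g′ j i))) ⟩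
    sum (λ i → sum (edgeTerm g i) + sum (λ j → edgeTerm g′ j i))
      ≡⟨ ∑-distrib-+ (λ i → sum (edgeTerm g i)) (λ i → sum (λ j → edgeTerm g′ j i)) ⟩
    sum (λ i → sum (edgeTerm g i)) + sum (λ i → sum (λ j → edgeTerm g′ j i))
      ≡⟨ cong (sum (λ i → sum (edgeTerm g i)) +_) (∑-comm (λ i j → edgeTerm g′ j i)) ⟩
    sum (λ i → sum (edgeTerm g i)) + sum (λ j → sum (edgeTerm g′ j))
      ≡⟨ cong₂ _+_ (edgeSum≡sum g) (edgeSum≡sum g′) ⟨
    edgeSum G g + edgeSum G g′ ∎
    where
    open ≡-Reasoning
    g′ : Fin n → Fin n → ℕ
    g′ i j = g j i
    orientations : ∀ i j → (if adj G i j then g i j else 0) ≡ edgeTerm g i j + edgeTerm g′ j i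
    orientations i j rewrite Graph.sym G j i with adj G i j in ij
    ... | false rewrite ∧-zeroʳ (toℕ i <ᵇ toℕ j) | ∧-zeroʳ (toℕ j <ᵇ toℕ i) = refl
    ... | true with <-cmp (toℕ i) (toℕ j)
    ...   | tri< i<j _ _ rewrite <ᵇ-true i<j | <ᵇ-false (<⇒≤ i<j) = sym (+-identityʳ _)
    ...   | tri≈ _ i≡j _ = contradiction (toℕ-injective i≡j) (adj⇒≢ ij)
    ...   | tri> _ _ j<i rewrite <ᵇ-false (<⇒≤ j<i) | <ᵇ-true j<i = refl

  degree-sum : sum (degree G) ≡ numEdges G + numEdges G
  degree-sum = trans (sum-cong-≗ λ i → trans (Σᵥ≡sum (λ j → b2n (adj G i j))) (sum-cong-≗ (b2n≡if ∘ adj G i)))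
                     (adjacency-sum (λ _ _ → 1))
    where
    b2n≡if : ∀ b → b2n b ≡ (if b then 1 else 0)
    b2n≡if true  = refl
    b2n≡if false = refl

  lowerNeighbours : (Fin n → ℕ) → Fin n → ℕ
  lowerNeighbours h w = count (λ x → adj G w x ∧ (h x <ᵇ h w))

  flatEdges : (Fin n → ℕ) → ℕ
  flatEdges h = edgeSum G (λ i j → b2n (h i ≡ᵇ h j))

  lower+flat≡edges : ∀ h → sum (lowerNeighbours h) + flatEdges h ≡ numEdges G
  lower+flat≡edges h = begin
    sum (lowerNeighbours h) + flatEdges h
      ≡⟨ cong (_+ flatEdges h) (trans (sum-cong-≗ (λ w → sum-cong-≗ (λ x → b2n-∧ (adj G w x) _)))
                                     (adjacency-sum down)) ⟩
    edgeSum G down + edgeSum G up + flatEdges h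
      ≡⟨ cong (_+ flatEdges h) (edgeSum-+ down up) ⟩
    edgeSum G (λ i j → down i j + up i j) + flatEdges h
      ≡⟨ edgeSum-+ (λ i j → down i j + up i j) (λ i j → b2n (h i ≡ᵇ h j)) ⟩
    edgeSum G (λ i j → down i j + up i j + b2n (h i ≡ᵇ h j))
      ≡⟨ edgeSum-cong (λ i j _ → <ᵇ-trichotomy (h i) (h j)) ⟩
    numEdges G ∎
    where
    open ≡-Reasoning
    down up : Fin n → Fin n → ℕ
    down i j = b2n (h j <ᵇ h i)
    up   i j = b2n (h i <ᵇ h j)

-- Pendent vertices

module _ {n} (G : Graph n) where

  pendents : ℕ
  pendents = count (isPendent G)

  pendent⇒degree≡1 : ∀ {w} → isPendent G w ≡ true → degree G w ≡ 1
  pendent⇒degree≡1 {w} = ⌊⌋-toWitness (degree G w ≟ 1)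

  degree≡1⇒pendent : ∀ {w} → degree G w ≡ 1 → isPendent G w ≡ true
  degree≡1⇒pendent {w} = ⌊⌋-fromWitness (degree G w ≟ 1)

  degree≡count : ∀ w → degree G w ≡ count (adj G w)
  degree≡count w = Σᵥ≡sum (λ x → b2n (adj G w x))

  pendent-neighbour-unique : ∀ {w a b} → isPendent G w ≡ true → adj G w a ≡ true → adj G w b ≡ true → a ≡ b
  pendent-neighbour-unique {w} {a} {b} pw wa wb with a ≟ᶠ b
  ... | yes a≡b = a≡b
  ... | no  a≢b = contradiction
    (subst (2 ≤_) (trans (sym (degree≡count w)) (pendent⇒degree≡1 pw)) (2≤count {p = adj G w} a≢b wa wb))
    1+n≰n

  unique-neighbour⇒pendent : ∀ {w p} → adj G w p ≡ true → (∀ y → adj G w y ≡ true → y ≡ p) → isPendent G w ≡ true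
  unique-neighbour⇒pendent {w} {p} wp only-p =
    degree≡1⇒pendent (trans (degree≡count w) (trans (count-cong neighbour≡p) (count-≟ p)))
    where
    neighbour≡p : ∀ y → adj G w y ≡ ⌊ y ≟ᶠ p ⌋
    neighbour≡p y with adj G w y in wy | y ≟ᶠ p
    ... | true  | yes _   = refl
    ... | true  | no  y≢p = contradiction (only-p y wy) y≢p
    ... | false | yes refl = trans (sym wy) wp
    ... | false | no  _   = refl

  ℓ+ℓ≡ : ∀ u v → ℓ G u v + ℓ G v u ≡ count (λ w → isPendent G w ∧ not (dist G w u ≡ᵇ dist G w v))
  ℓ+ℓ≡ u v = begin
    ℓ G u v + ℓ G v u
      ≡⟨ cong₂ _+_ (Σᵥ≡sum (b2n ∘ closer u v)) (Σᵥ≡sum (b2n ∘ closer v u)) ⟩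
    count (closer u v) + count (closer v u)
      ≡⟨ ∑-distrib-+ (b2n ∘ closer u v) (b2n ∘ closer v u) ⟨
    sum (λ w → b2n (closer u v w) + b2n (closer v u w))
      ≡⟨ sum-cong-≗ (λ w → pointwise (isPendent G w) (dist G w u) (dist G w v)) ⟩
    count (λ w → isPendent G w ∧ not (dist G w u ≡ᵇ dist G w v)) ∎
    where
    open ≡-Reasoning
    closer : Fin n → Fin n → Fin n → Bool
    closer a b w = isPendent G w ∧ (dist G w a <ᵇ dist G w b)
    pointwise : ∀ p a b → b2n (p ∧ (a <ᵇ b)) + b2n (p ∧ (b <ᵇ a)) ≡ b2n (p ∧ not (a ≡ᵇ b))
    pointwise true  a b = <ᵇ+>ᵇ a b
    pointwise false a b = refl

  ℓ+ℓ≤pendents : ∀ u v → ℓ G u v + ℓ G v u ≤ pendents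
  ℓ+ℓ≤pendents u v =
    subst (_≤ pendents) (sym (ℓ+ℓ≡ u v)) (count-mono (λ w → proj₁ ∘ ∧-elim (isPendent G w)))

∣-∣≤∸2 : ∀ {a b p} → 1 ≤ a → 1 ≤ b → a + b ≤ p → ∣ a - b ∣ ≤ p ∸ 2
∣-∣≤∸2 {suc a} {suc b} {p} _ _ a+b≤p = ≤-trans (≤-trans (∣m-n∣≤m⊔n a b) (m⊔n≤m+n a b))
  (m+n≤o⇒m≤o∸n (a + b) (subst (_≤ p) (trans (cong suc (+-suc a b)) (+-comm 2 (a + b))) a+b≤p))

∸2≤∣-∣ : ∀ {a b p} → a ≤ 1 → p ≤ a + b → p ∸ 2 ≤ ∣ a - b ∣
∸2≤∣-∣ {zero}        {b}     {p} _ p≤b = ≤-trans (m∸n≤m p 2) p≤b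
∸2≤∣-∣ {suc zero}    {zero}  {p} _ p≤1 = ≤-trans (∸-monoˡ-≤ 2 p≤1) z≤n
∸2≤∣-∣ {suc zero}    {suc b} {p} _ p≤2+b = ∸-monoˡ-≤ 2 p≤2+b
∸2≤∣-∣ {suc (suc a)} (s≤s ())

-- Trees

IsStarCentredAt : ∀ {n} → Graph n → Fin n → Set
IsStarCentredAt G c = (∀ w → w ≢ c → adj G w c ≡ true) × (∀ w w′ → w ≢ c → w′ ≢ c → adj G w w′ ≡ false)

module Tree {m} (G : Graph (suc m)) (tree : IsTree G) where

  open Distances G (proj₁ tree)

  -- Every vertex other than r has a lower neighbour, yet all lower neighbours and flat edges
  -- together number only m: so no edge is flat and nobody has two lower neighbours.
  module _ (r : Fin (suc m)) where

    private
      lower : Fin (suc m) → ℕ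
      lower = lowerNeighbours G (dist G r)

    nonroot≤lower : ∀ w → b2n (not ⌊ w ≟ᶠ r ⌋) ≤ lower w
    nonroot≤lower w with w ≟ᶠ r
    ... | yes _   = z≤n
    ... | no  w≢r with x , wx , x-below ← parent (≢-sym w≢r) =
      1≤count {p = λ y → adj G w y ∧ (dist G r y <ᵇ dist G r w)} {x}
        (cong₂ _∧_ wx (<ᵇ-true (≤-reflexive x-below)))

    m≤Σlower : m ≤ sum lower
    m≤Σlower = subst (_≤ sum lower) (count-≢ r) (sum-mono-≤ nonroot≤lower)

    Σlower+flat≡m : sum lower + flatEdges G (dist G r) ≡ m
    Σlower+flat≡m = trans (lower+flat≡edges G (dist G r)) (proj₂ tree)

    no-flat-edges : flatEdges G (dist G r) ≡ 0
    no-flat-edges = n≤0⇒n≡0 (+-cancelˡ-≤ m _ 0 (begin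
      m + flatEdges G (dist G r)        ≤⟨ +-monoˡ-≤ _ m≤Σlower ⟩
      sum lower + flatEdges G (dist G r) ≡⟨ Σlower+flat≡m ⟩
      m                                 ≡⟨ +-identityʳ m ⟨
      m + 0                             ∎))
      where open ≤-Reasoning

    adj⇒dist≢ : ∀ {a b} → adj G a b ≡ true → dist G r a ≢ dist G r b
    adj⇒dist≢ {a} {b} ab same-level = 1+n≰n (begin
      1                                  ≡⟨ cong b2n (≡ᵇ-true same-level) ⟨
      b2n (dist G r a ≡ᵇ dist G r b)     ≤⟨ edge≤edgeSum G _ (λ i j → cong b2n (≡ᵇ-comm (dist G r i) _)) ab ⟩
      flatEdges G (dist G r)             ≡⟨ no-flat-edges ⟩
      0                                  ∎)
      where open ≤-Reasoning

    lower≤1 : ∀ w → lower w ≤ 1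
    lower≤1 w = ≮⇒≥ λ 1<lower → <⇒≱ (more-than-m 1<lower) Σlower≤m
      where
      Σlower≤m : sum lower ≤ m
      Σlower≤m = subst (sum lower ≤_) Σlower+flat≡m (m≤m+n _ _)
      more-than-m : 1 < lower w → m < sum lower
      more-than-m 1<lower = subst (_< sum lower) (count-≢ r)
        (sum-mono-< nonroot≤lower w (≤-trans (s≤s (b2n≤1 _)) 1<lower))

    parent-unique : ∀ {w x y} → adj G w x ≡ true → adj G w y ≡ true →
      dist G r x < dist G r w → dist G r y < dist G r w → x ≡ y
    parent-unique {w} {x} {y} wx wy x-below y-below with x ≟ᶠ y
    ... | yes x≡y = x≡y
    ... | no  x≢y = contradiction (lower≤1 w) (<⇒≱ (2≤count {p = λ z → adj G w z ∧ (dist G r z <ᵇ dist G r w)}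
      x≢y (cong₂ _∧_ wx (<ᵇ-true x-below)) (cong₂ _∧_ wy (<ᵇ-true y-below))))

  child : ∀ {r z} → r ≢ z → isPendent G z ≡ false → ∃ λ y → adj G z y ≡ true × dist G r z < dist G r y
  child {r} {z} r≢z z-inner with p , zp , p-below ← parent r≢z
    with any? (λ y → (adj G z y ≟ᵇ true) ×-dec ¬? (y ≟ᶠ p))
  ... | yes (y , zy , y≢p) = y , zy , above
    where
    above : dist G r z < dist G r y
    above with <-cmp (dist G r z) (dist G r y)
    ... | tri< z<y _ _ = z<y
    ... | tri≈ _ z≡y _ = contradiction z≡y (adj⇒dist≢ r zy)
    ... | tri> _ _ y<z = contradiction (parent-unique r zp zy (≤-reflexive p-below) y<z) (≢-sym y≢p)
  ... | no none = contradiction (trans (sym (unique-neighbour⇒pendent G zp only-p)) z-inner) λ ()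
    where
    only-p : ∀ y → adj G z y ≡ true → y ≡ p
    only-p y zy with y ≟ᶠ p
    ... | yes y≡p = y≡p
    ... | no  y≢p = contradiction (y , zy , y≢p) none

  module _ {u v} (uv : adj G u v ≡ true) where

    NearU : Fin (suc m) → Set
    NearU z = dist G u z < dist G v z

    near-u : NearU u
    near-u = subst (_< dist G v u) (sym (dist-self u))
      (n≢0⇒n>0 (λ d≡0 → adj⇒≢ G uv (sym (dist≡0⇒≡ d≡0))))

    near⇒≢v : ∀ {z} → NearU z → v ≢ z
    near⇒≢v {z} near refl = n≮0 (subst (dist G u z <_) (dist-self v) near)

    -- Moving to a child keeps a vertex on u's side; its distance from v grows and is at most m,
    -- which is what the budget k accounts for.
    pendent-near : ∀ k z → m ≤ k + dist G v z → NearU z → ∃ λ w → isPendent G w ≡ true × NearU w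
    pendent-near k z bound near with isPendent G z in pz
    ... | true  = z , pz , near
    ... | false with y , zy , z<y ← child (near⇒≢v near) pz with k
    ...   | zero  = contradiction (≤-trans (s≤s bound) z<y) λ 1+m≤dist →
                      1+n≰n (≤-trans 1+m≤dist (dist≤m G (proj₁ tree) v y))
    ...   | suc k = pendent-near k y
                      (≤-trans bound (≤-trans (≤-reflexive (sym (+-suc k _))) (+-monoʳ-≤ k z<y)))
                      (≤-trans (s≤s (adj⇒dist≤1+dist u (trans (Graph.sym G y z) zy))) (≤-trans (s≤s near) z<y))

    1≤ℓ : 1 ≤ ℓ G u v
    1≤ℓ with w , pw , near ← pendent-near m u (m≤m+n m _) near-u =
      subst (1 ≤_) (sym (Σᵥ≡sum (λ z → b2n (isPendent G z ∧ (dist G z u <ᵇ dist G z v)))))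
        (1≤count {p = λ z → isPendent G z ∧ (dist G z u <ᵇ dist G z v)} {w}
          (cong₂ _∧_ pw (<ᵇ-true (subst₂ _<_ (dist-sym G u w) (dist-sym G v w) near))))

  -- Any other vertex reaches u through u's only neighbour v.
  ℓ≤1 : ∀ {u v} → isPendent G u ≡ true → adj G u v ≡ true → ℓ G u v ≤ 1
  ℓ≤1 {u} {v} pu uv = subst₂ _≤_ (sym (Σᵥ≡sum (λ z → b2n (isPendent G z ∧ (dist G z u <ᵇ dist G z v)))))
    (count-≟ u) (count-mono only-u)
    where
    only-u : ∀ z → isPendent G z ∧ (dist G z u <ᵇ dist G z v) ≡ true → ⌊ z ≟ᶠ u ⌋ ≡ true
    only-u z closer with z ≟ᶠ u
    ... | yes _   = refl
    ... | no  z≢u with x , ux , x-below ← parent z≢u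
      with refl ← pendent-neighbour-unique G pu ux uv =
      contradiction (<ᵇ-sound (proj₂ (∧-elim (isPendent G z) closer))) (<-asym (≤-reflexive x-below))

  pendents≤ℓ+ℓ : ∀ {u v} → adj G u v ≡ true → pendents G ≤ ℓ G u v + ℓ G v u
  pendents≤ℓ+ℓ {u} {v} uv = subst (pendents G ≤_) (sym (ℓ+ℓ≡ G u v)) (count-mono separated)
    where
    separated : ∀ w → isPendent G w ≡ true → isPendent G w ∧ not (dist G w u ≡ᵇ dist G w v) ≡ true
    separated w pw = cong₂ _∧_ pw (cong not (≡ᵇ-false (adj⇒dist≢ w uv)))

  not-all-pendent : 2 ≤ m → ¬ (∀ w → isPendent G w ≡ true)
  not-all-pendent 2≤m all-pendent = 1+n≰n (subst (2 ≤_) (+-cancelˡ-≡ m m 1 m+m≡m+1) 2≤m)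
    where
    open ≡-Reasoning
    m+m≡m+1 : m + m ≡ m + 1
    m+m≡m+1 = begin
      m + m                      ≡⟨ cong₂ _+_ (proj₂ tree) (proj₂ tree) ⟨
      numEdges G + numEdges G    ≡⟨ degree-sum G ⟨
      sum (degree G)             ≡⟨ sum-cong-≗ (pendent⇒degree≡1 G ∘ all-pendent) ⟩
      count {suc m} (λ _ → true) ≡⟨ count-true (suc m) ⟩
      suc m                      ≡⟨ +-comm 1 m ⟩
      m + 1                      ∎

  inner-vertex : 2 ≤ m → ∃ λ c → isPendent G c ≡ false
  inner-vertex 2≤m = map₂ ¬-not (¬∀⟶∃¬ (suc m) _ (λ w → isPendent G w ≟ᵇ true) (not-all-pendent 2≤m))

  1≤inner-count : 2 ≤ m → 1 ≤ count (λ w → not (isPendent G w))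
  1≤inner-count 2≤m = let c , c-inner = inner-vertex 2≤m in
    1≤count {p = λ w → not (isPendent G w)} {c} (cong not c-inner)

  pendents≤m : 2 ≤ m → pendents G ≤ m
  pendents≤m 2≤m = ≤-pred (subst (_≤ suc m) (+-comm (pendents G) 1)
    (subst (pendents G + 1 ≤_) (count-complement (isPendent G))
      (+-monoʳ-≤ (pendents G) (1≤inner-count 2≤m))))

  an-edge : 1 ≤ m → ∃ λ u → ∃ λ v → adj G u v ≡ true
  an-edge 1≤m = let v , one-v , _ = parent zero≢one in one , v , one-v
    where
    one : Fin (suc m)
    one = fromℕ< (s≤s 1≤m)
    zero≢one : zero ≢ one
    zero≢one eq = contradiction (trans (cong toℕ eq) (toℕ-fromℕ< (s≤s 1≤m))) λ ()

  2≤pendents : 1 ≤ m → 2 ≤ pendents G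
  2≤pendents 1≤m with u , v , uv ← an-edge 1≤m =
    ≤-trans (+-mono-≤ (1≤ℓ uv) (1≤ℓ (trans (Graph.sym G v u) uv))) (ℓ+ℓ≤pendents G u v)

  edge-contribution≤ : ∀ {u v} → adj G u v ≡ true → ∣ ℓ G u v - ℓ G v u ∣ ≤ pendents G ∸ 2
  edge-contribution≤ {u} {v} uv = ∣-∣≤∸2 (1≤ℓ uv) (1≤ℓ (trans (Graph.sym G v u) uv)) (ℓ+ℓ≤pendents G u v)

  MoT≤m*[pendents∸2] : MoT G ≤ m * (pendents G ∸ 2)
  MoT≤m*[pendents∸2] = begin
    MoT G                               ≤⟨ edgeSum-mono G {λ u v → ∣ ℓ G u v - ℓ G v u ∣} {λ _ _ → pendents G ∸ 2}
                                             (λ _ _ → edge-contribution≤) ⟩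
    edgeSum G (λ _ _ → pendents G ∸ 2)  ≡⟨ edgeSum-const G (pendents G ∸ 2) ⟩
    (pendents G ∸ 2) * numEdges G       ≡⟨ cong ((pendents G ∸ 2) *_) (proj₂ tree) ⟩
    (pendents G ∸ 2) * m                ≡⟨ *-comm _ m ⟩
    m * (pendents G ∸ 2)                ∎
    where open ≤-Reasoning

  MoT≤ : 2 ≤ m → MoT G ≤ m * (m ∸ 2)
  MoT≤ 2≤m = ≤-trans MoT≤m*[pendents∸2] (*-monoʳ-≤ m (∸-monoˡ-≤ 2 (pendents≤m 2≤m)))

  MoT≡⇒pendents≡m : 2 ≤ m → MoT G ≡ m * (m ∸ 2) → pendents G ≡ m
  MoT≡⇒pendents≡m 2≤m MoT≡ = ≤-antisym (pendents≤m 2≤m) (≮⇒≥ λ pendents<m →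
    <⇒≱ (*-monoʳ-< m {{>-nonZero 1≤m}} (∸-monoˡ-< pendents<m (2≤pendents 1≤m)))
        (subst (_≤ m * (pendents G ∸ 2)) MoT≡ MoT≤m*[pendents∸2]))
    where
    1≤m : 1 ≤ m
    1≤m = ≤-trans (s≤s z≤n) 2≤m

  others-pendent : pendents G ≡ m → ∀ {c} → isPendent G c ≡ false → ∀ {w} → w ≢ c → isPendent G w ≡ true
  others-pendent pendents≡m {c} c-inner {w} w≢c = ¬-not λ w-inner → 1+n≰n (subst (2 ≤_) inner≡1
    (2≤count {p = λ x → not (isPendent G x)} w≢c (cong not w-inner) (cong not c-inner)))
    where
    inner≡1 : count (λ x → not (isPendent G x)) ≡ 1
    inner≡1 = +-cancelˡ-≡ m _ 1 (begin
      m + count (λ x → not (isPendent G x))           ≡⟨ cong (_+ count (λ x → not (isPendent G x))) pendents≡m ⟨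
      pendents G + count (λ x → not (isPendent G x))  ≡⟨ count-complement (isPendent G) ⟩
      suc m                                           ≡⟨ +-comm 1 m ⟩
      m + 1                                           ∎)
      where open ≡-Reasoning

  star-centred : ∀ {c} → (∀ {w} → w ≢ c → isPendent G w ≡ true) → IsStarCentredAt G c
  star-centred {c} leaf = centre-adj , leaves-nonadj
    where
    -- If the parent x of w were not c, x would be pendent with w as its only neighbour,
    -- so w would also be the parent of x.
    centre-adj : ∀ w → w ≢ c → adj G w c ≡ true
    centre-adj w w≢c with x , wx , x-below ← parent (≢-sym w≢c) with x ≟ᶠ c
    ... | yes refl = wx
    ... | no  x≢c with y , xy , y-below ← parent (≢-sym x≢c)
      with refl ← pendent-neighbour-unique G (leaf x≢c) xy (trans (Graph.sym G x w) wx) =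
      contradiction (≤-reflexive x-below) (<-asym (≤-reflexive y-below))
    leaves-nonadj : ∀ w w′ → w ≢ c → w′ ≢ c → adj G w w′ ≡ false
    leaves-nonadj w w′ w≢c w′≢c with adj G w w′ in ww′
    ... | false = refl
    ... | true  = contradiction (pendent-neighbour-unique G (leaf w≢c) ww′ (centre-adj w w≢c)) w′≢c

  module _ {c} (star : IsStarCentredAt G c) (2≤m : 2 ≤ m) where

    leaf-pendent : ∀ {w} → w ≢ c → isPendent G w ≡ true
    leaf-pendent {w} w≢c = unique-neighbour⇒pendent G (proj₁ star w w≢c) only-c
      where
      only-c : ∀ y → adj G w y ≡ true → y ≡ c
      only-c y wy with y ≟ᶠ c
      ... | yes y≡c = y≡c
      ... | no  y≢c = contradiction (trans (sym wy) (proj₂ star w y w≢c y≢c)) λ ()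

    centre-inner : isPendent G c ≡ false
    centre-inner = ¬-not λ c-pendent →
      1+n≰n (subst (2 ≤_) (trans (sym centre-degree) (pendent⇒degree≡1 G c-pendent)) 2≤m)
      where
      neighbour≡leaf : ∀ y → adj G c y ≡ not ⌊ y ≟ᶠ c ⌋
      neighbour≡leaf y with y ≟ᶠ c
      ... | yes refl = Graph.irrefl G c
      ... | no  y≢c  = trans (Graph.sym G c y) (proj₁ star y y≢c)
      centre-degree : degree G c ≡ m
      centre-degree = trans (degree≡count G c) (trans (count-cong neighbour≡leaf) (count-≢ c))

    pendents≡m : pendents G ≡ m
    pendents≡m = trans (count-cong pendent≡leaf) (count-≢ c)
      where
      pendent≡leaf : ∀ w → isPendent G w ≡ not ⌊ w ≟ᶠ c ⌋
      pendent≡leaf w with w ≟ᶠ c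
      ... | yes refl = centre-inner
      ... | no  w≢c  = leaf-pendent w≢c

    leaf-edge-contribution≥ : ∀ {a b} → a ≢ c → adj G a b ≡ true → m ∸ 2 ≤ ∣ ℓ G a b - ℓ G b a ∣
    leaf-edge-contribution≥ {a} {b} a≢c ab =
      ∸2≤∣-∣ (ℓ≤1 (leaf-pendent a≢c) ab) (subst (_≤ ℓ G a b + ℓ G b a) pendents≡m (pendents≤ℓ+ℓ ab))

    edge-contribution≥ : ∀ {i j} → adj G i j ≡ true → m ∸ 2 ≤ ∣ ℓ G i j - ℓ G j i ∣
    edge-contribution≥ {i} {j} ij with i ≟ᶠ c
    ... | no  i≢c  = leaf-edge-contribution≥ i≢c ij
    ... | yes refl = subst (m ∸ 2 ≤_) (∣-∣-comm (ℓ G j c) (ℓ G c j))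
                       (leaf-edge-contribution≥ (λ j≡c → adj⇒≢ G ij (sym j≡c)) (trans (Graph.sym G j c) ij))

    MoT-star : MoT G ≡ m * (m ∸ 2)
    MoT-star = ≤-antisym (MoT≤ 2≤m) (begin
      m * (m ∸ 2)               ≡⟨ *-comm m _ ⟩
      (m ∸ 2) * m               ≡⟨ cong ((m ∸ 2) *_) (proj₂ tree) ⟨
      (m ∸ 2) * numEdges G      ≡⟨ edgeSum-const G (m ∸ 2) ⟨
      edgeSum G (λ _ _ → m ∸ 2) ≤⟨ edgeSum-mono G {λ _ _ → m ∸ 2} {λ u v → ∣ ℓ G u v - ℓ G v u ∣}
                                     (λ _ _ → edge-contribution≥) ⟩
      MoT G                     ∎)
      where open ≤-Reasoning

-- Stars

starAdj-centre : ∀ {m} {b : Fin (suc m)} → b ≢ zero → starAdj zero b ≡ true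
starAdj-centre {b = zero}  b≢0 = contradiction refl b≢0
starAdj-centre {b = suc _} _   = refl

starAdj-leaves : ∀ {m} {a b : Fin (suc m)} → a ≢ zero → b ≢ zero → starAdj a b ≡ false
starAdj-leaves {a = zero}  a≢0 _   = contradiction refl a≢0
starAdj-leaves {b = zero}  _   b≢0 = contradiction refl b≢0
starAdj-leaves {a = suc _} {suc _} _ _ = refl

star-centred⇒≅star : ∀ {m} (G : Graph (suc m)) {c} → IsStarCentredAt G c → G ≅ star m
star-centred⇒≅star {m} G {c} (centre-adj , leaves-nonadj) = Permutation.transpose c zero , preserves
  where
  τ : Fin (suc m) → Fin (suc m)
  τ = Transposition.transpose c zero
  τc≡0 : τ c ≡ zero
  τc≡0 with c ≟ᶠ c
  ... | yes _   = refl
  ... | no  c≢c = contradiction refl c≢c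
  τ≢0 : ∀ {k} → k ≢ c → τ k ≢ zero
  τ≢0 {k} k≢c with k ≟ᶠ c
  ... | yes k≡c = contradiction k≡c k≢c
  ... | no  _ with k ≟ᶠ zero
  ...   | yes refl = ≢-sym k≢c
  ...   | no  k≢0  = k≢0
  preserves : ∀ i j → starAdj (τ i) (τ j) ≡ adj G i j
  preserves i j = by-cases (i ≟ᶠ c) (j ≟ᶠ c)
    where
    open ≡-Reasoning
    by-cases : Dec (i ≡ c) → Dec (j ≡ c) → starAdj (τ i) (τ j) ≡ adj G i j
    by-cases (yes refl) (yes refl) = trans (cong₂ starAdj τc≡0 τc≡0) (sym (Graph.irrefl G c))
    by-cases (yes refl) (no j≢c)   = begin
      starAdj (τ c) (τ j)  ≡⟨ cong (λ x → starAdj x (τ j)) τc≡0 ⟩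
      starAdj zero (τ j)   ≡⟨ starAdj-centre (τ≢0 j≢c) ⟩
      true                 ≡⟨ centre-adj j j≢c ⟨
      adj G j c            ≡⟨ Graph.sym G j c ⟩
      adj G c j            ∎
    by-cases (no i≢c) (yes refl)   = begin
      starAdj (τ i) (τ c)  ≡⟨ cong (starAdj (τ i)) τc≡0 ⟩
      starAdj (τ i) zero   ≡⟨ Graph.sym (star m) (τ i) zero ⟩
      starAdj zero (τ i)   ≡⟨ starAdj-centre (τ≢0 i≢c) ⟩
      true                 ≡⟨ centre-adj i i≢c ⟨
      adj G i c            ∎
    by-cases (no i≢c) (no j≢c)     = trans (starAdj-leaves (τ≢0 i≢c) (τ≢0 j≢c)) (sym (leaves-nonadj i j i≢c j≢c))

≅star⇒star-centred : ∀ {m} (G : Graph (suc m)) → G ≅ star m → ∃ (IsStarCentredAt G)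
≅star⇒star-centred {m} G (φ , preserves) = from zero , centre-adj , leaves-nonadj
  where
  open Inverse φ
  to≢0 : ∀ {w} → w ≢ from zero → to w ≢ zero
  to≢0 {w} w≢c eq = w≢c (trans (sym (strictlyInverseʳ w)) (cong from eq))
  centre-adj : ∀ w → w ≢ from zero → adj G w (from zero) ≡ true
  centre-adj w w≢c = trans (sym (preserves w (from zero)))
    (trans (cong (starAdj (to w)) (strictlyInverseˡ zero))
           (trans (Graph.sym (star m) (to w) zero) (starAdj-centre (to≢0 w≢c))))
  leaves-nonadj : ∀ w w′ → w ≢ from zero → w′ ≢ from zero → adj G w w′ ≡ false
  leaves-nonadj w w′ w≢c w′≢c = trans (sym (preserves w w′)) (starAdj-leaves (to≢0 w≢c) (to≢0 w′≢c))

mainTheorem7 : ∀ m → 3 ≤ suc m →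
    ((T : Graph (suc m)) → IsTree T → MoT T ≤ m * (m ∸ 2))
    × ((T : Graph (suc m)) → IsTree T → (MoT T ≡ m * (m ∸ 2) ⇔ T ≅ star m))
mainTheorem7 m 3≤n =
  (λ T tree → Tree.MoT≤ T tree 2≤m) , λ T tree → mk⇔ (extremal⇒star T tree) (star⇒extremal T tree)
  where
  2≤m : 2 ≤ m
  2≤m = s≤s⁻¹ 3≤n
  extremal⇒star : (T : Graph (suc m)) → IsTree T → MoT T ≡ m * (m ∸ 2) → T ≅ star m
  extremal⇒star T tree MoT≡ =
    let open Tree T tree
        c , c-inner = inner-vertex 2≤m
    in star-centred⇒≅star T (star-centred (others-pendent (MoT≡⇒pendents≡m 2≤m MoT≡) c-inner))
  star⇒extremal : (T : Graph (suc m)) → IsTree T → T ≅ star m → MoT T ≡ m * (m ∸ 2)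
  star⇒extremal T tree T≅star =
    let c , centred = ≅star⇒star-centred T T≅star in Tree.MoT-star T tree centred 2≤m
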